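{- Let $n\geq 1$ and consider the normed BPA system $\Delta_0$ described in the context. Let $\alpha$ be a process with $\mathrm{Var}(\alpha)\subseteq\mathcal{B}$, let $1\le i\le n$ and $b\in\{0,1\}$. Then: (1) $Z_i^b\alpha\simeq\alpha$ if and only if there are processes $\alpha_1,\alpha_2$ with $\alpha=\alpha_1B_i^b\alpha_2$ and $B_i^{1-b}\notin\mathrm{Var}(\alpha_1)$; (2) $Z_i^b\alpha\simeq\alpha$ implies $Z_i^{1-b}\alpha\not\simeq\alpha$.
   Context: BPA systems: a BPA system $(\mathcal{V},\mathcal{A},\mathcal{R})$ has finite sets of variables, actions (containing the internal action $\tau$) and rules $X\xrightarrow{\lambda}\alpha$; processes are words over $\mathcal{V}$; if $X\xrightarrow{\lambda}\alpha$ is a rule then $X\beta\xrightarrow{\lambda}\alpha\beta$. Write $\to$ for $\xrightarrow{\tau}$, $\Rightarrow$ for its reflexive transitive closure, $\mathrm{Var}(\alpha)$ for the set of variables occurring in $\alpha$. A symmetric relation $R$ is a branching bisimulation if whenever $\alpha R\beta$ and $\alpha\xrightarrow{\lambda}\alpha'$, either ($\lambda=\tau$ and $\alpha'R\beta$) or $\beta\Rightarrow\beta''\xrightarrow{\lambda}\beta'$ with $\alpha R\beta''$ and $\alpha'R\beta'$; $\simeq$ is the largest branching bisimulation. The system $\Delta_0$: variables $\mathcal{B}\uplus\mathcal{B}'$ with $\mathcal{B}=\{B_i^0,B_i^1\mid 1\le i\le n\}$ and $\mathcal{B}'=\{Z_i^0,Z_i^1\mid 1\le i\le n\}\cup\{B_i^b(j,b')\mid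 1\le i,j\le n,\ i\ne j,\ b,b'\in\{0,1\}\}$; actions $\{d,\tau\}\cup\{a_i^0,a_i^1\mid 1\le i\le n\}$; rules, for all $1\le i,j,j'\le n$ and $b,b',b''\in\{0,1\}$: $Z_i^b\xrightarrow{a_i^b}\epsilon$, $Z_i^b\xrightarrow{\tau}\epsilon$; $B_i^b\xrightarrow{a_i^b}B_i^b$, $B_i^b\xrightarrow{d}\epsilon$, $B_i^b\xrightarrow{a_j^{b'}}B_i^b(j,b')$ for $j\ne i$; $B_i^b(j,b')\xrightarrow{a_i^b}B_i^b(j,b')$, $B_i^b(j,b')\xrightarrow{d}Z_j^{b'}$, $B_i^b(j,b')\xrightarrow{a_{j'}^{b''}}B_i^b(j',b'')$ for $j\ne i$, $j'\ne i$. -}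

module Defs where

open import Data.Nat using (ℕ)
open import Data.Fin using (Fin)
open import Data.Bool using (Bool)
open import Data.List using (List; []; _∷_; _++_)
open import Data.Product using (Σ; _×_; _,_; ∃; ∃₂)
open import Data.Sum using (_⊎_)
open import Relation.Binary.PropositionalEquality using (_≡_; _≢_)
open import Relation.Binary.Construct.Closure.ReflexiveTransitive using (Star)
open import Level using (0ℓ)

-- Variables of Δ₀ (parameter n).  B i b = B_i^b, Z i b = Z_i^b,
-- Bp i b j b' _ = B_i^b(j,b') with i ≠ j (irrelevant proof).
data Var (n : ℕ) : Set where
  B  : Fin n → Bool → Var n
  Z  : Fin n → Bool → Var n
  Bp : (i : Fin n) (b : Bool) (j : Fin n) (b' : Bool) → .(i ≢ j) → Var n

data Act (n : ℕ) : Set where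
  d : Act n
  τ : Act n
  a : Fin n → Bool → Act n

Proc : ℕ → Set
Proc n = List (Var n)

data Rule {n : ℕ} : Var n → Act n → Proc n → Set where
  Z-a   : ∀ {i b} → Rule (Z i b) (a i b) []
  Z-τ   : ∀ {i b} → Rule (Z i b) τ []
  B-a   : ∀ {i b} → Rule (B i b) (a i b) (B i b ∷ [])
  B-d   : ∀ {i b} → Rule (B i b) d []
  B-aj  : ∀ {i b j b'} (p : i ≢ j) → Rule (B i b) (a j b') (Bp i b j b' p ∷ [])
  Bp-a  : ∀ {i b j b'} .{p : i ≢ j} → Rule (Bp i b j b' p) (a i b) (Bp i b j b' p ∷ [])
  Bp-d  : ∀ {i b j b'} .{p : i ≢ j} → Rule (Bp i b j b' p) d (Z j b' ∷ [])
  Bp-aj : ∀ {i b j b' j' b''} .{p : i ≢ j} (q : i ≢ j') →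
          Rule (Bp i b j b' p) (a j' b'') (Bp i b j' b'' q ∷ [])

data Step {n : ℕ} : Proc n → Act n → Proc n → Set where
  step : ∀ {X l α β} → Rule X l α → Step (X ∷ β) l (α ++ β)

TauStep : ∀ {n} → Proc n → Proc n → Set
TauStep α β = Step α τ β

_⇒_ : ∀ {n} → Proc n → Proc n → Set
_⇒_ = Star TauStep

IsBranchingBisim : ∀ {n} → (Proc n → Proc n → Set) → Set
IsBranchingBisim {n} R =
  (∀ {α β} → R α β → R β α) ×
  (∀ {α β α' : Proc n} {l : Act n} → R α β → Step α l α' →
     (l ≡ τ × R α' β) ⊎
     ∃₂ λ β'' β' → (β ⇒ β'') × Step β'' l β' × R α β'' × R α' β')

_≃_ : ∀ {n} → Proc n → Proc n → Set₁
_≃_ {n} α β = Σ (Proc n → Proc n → Set) λ R → IsBranchingBisim R × R α β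

data IsB {n : ℕ} : Var n → Set where
  isB : ∀ {i b} → IsB (B i b)

module Submission where

-- Idea of the proof.  For α ∈ 𝓑* the relation Z_i^b α ≃ α is governed by
-- a single syntactic property, FirstIs i b α: "the first variable of index
-- i in α is B_i^b".
--
--  * Soundness: if FirstIs i b γ then an explicit relation (the identity plus
--    Z_i^b γ ~ γ and B_k^c γ ~ B_k^c(i,b) γ for k ≠ i, symmetrically) is a
--    branching bisimulation.  The τ-step Z_i^b → ε is absorbed, and the
--    action a_i^b of Z_i^b is mimicked by γ either directly by B_i^b or by
--    some B_k^c, k ≠ i, moving to B_k^c(i,b), which "remembers" Z_i^b.
--  * Completeness: processes of 𝓑* and of the form B_k^c(j,c')γ are
--    τ-stable, so a bisimulation must match their visible moves directly.
--    Playing a_i^b from Z_i^b α and then d forces α = B_i^b … or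
--    α = B_k^c γ with k ≠ i and Z_i^b γ related to γ; induction on α.
--  * FirstIs determines b, which gives part (2), and on 𝓑* it is
--    equivalent to the decomposition α = α₁ B_i^b α₂ with B_i^{1-b} ∉ α₁.

open import Defs
open import Data.Nat using (ℕ)
open import Data.Fin using (Fin)
open import Data.Fin.Properties using () renaming (_≟_ to _≟ᶠ_)
open import Data.Bool using (Bool; not)
open import Data.Bool.Properties using (¬-not; not-¬) renaming (_≟_ to _≟ᵇ_)
open import Data.List using ([]; _∷_; _++_)
open import Data.List.Relation.Unary.All using (All; []; _∷_)
open import Data.List.Relation.Unary.Any using (here; there)
open import Data.List.Membership.Propositional using (_∉_)
open import Data.Product using (_×_; ∃; ∃₂; _,_)
open import Data.Sum using (_⊎_; inj₁; inj₂)
open import Function.Bundles using (_⇔_; mk⇔)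
open import Relation.Binary.PropositionalEquality using (_≡_; _≢_; refl; sym; cong)
open import Relation.Binary.Construct.Closure.ReflexiveTransitive using (ε; _◅_)
open import Relation.Nullary using (¬_; yes; no; contradiction)

data FirstIs {n : ℕ} (i : Fin n) (b : Bool) : Proc n → Set where
  here  : ∀ {γ} → FirstIs i b (B i b ∷ γ)
  there : ∀ {k c γ} → k ≢ i → FirstIs i b γ → FirstIs i b (B k c ∷ γ)

firstIs-unique : ∀ {n} {i : Fin n} {b c α} → FirstIs i b α → FirstIs i c α → b ≡ c
firstIs-unique here        here          = refl
firstIs-unique here        (there k≢i _) = contradiction refl k≢i
firstIs-unique (there k≢i _) here        = contradiction refl k≢i
firstIs-unique (there _ f) (there _ g)   = firstIs-unique f g

Answer : ∀ {n} → (Proc n → Proc n → Set) → Proc n → Proc n → Act n → Proc n → Set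
Answer R α β l α' =
  (l ≡ τ × R α' β) ⊎ ∃₂ λ β'' β' → (β ⇒ β'') × Step β'' l β' × R α β'' × R α' β'

data Absorb {n : ℕ} (i : Fin n) (b : Bool) : Proc n → Proc n → Set where
  refl-rel : ∀ {α} → Absorb i b α α
  Z-left   : ∀ {γ} → FirstIs i b γ → Absorb i b (Z i b ∷ γ) γ
  Z-right  : ∀ {γ} → FirstIs i b γ → Absorb i b γ (Z i b ∷ γ)
  Bp-left  : ∀ {k c γ} (k≢i : k ≢ i) → FirstIs i b γ →
             Absorb i b (Bp k c i b k≢i ∷ γ) (B k c ∷ γ)
  Bp-right : ∀ {k c γ} (k≢i : k ≢ i) → FirstIs i b γ →
             Absorb i b (B k c ∷ γ) (Bp k c i b k≢i ∷ γ)

absorb-sym : ∀ {n} {i : Fin n} {b α β} → Absorb i b α β → Absorb i b β α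
absorb-sym refl-rel       = refl-rel
absorb-sym (Z-left f)     = Z-right f
absorb-sym (Z-right f)    = Z-left f
absorb-sym (Bp-left p f)  = Bp-right p f
absorb-sym (Bp-right p f) = Bp-left p f

-- Absorb is a branching bisimulation.  The τ-step of Z_i^b on the left is
-- absorbed; on the right Z_i^b first performs its τ-step; every other move
-- is answered by a single matching step.
absorb-bisim : ∀ {n} (i : Fin n) (b : Bool) → IsBranchingBisim (Absorb i b)
absorb-bisim i b = absorb-sym , transfer
  where
  matched : ∀ {α β β'' α' β' l} → β ⇒ β'' → Step β'' l β' →
            Absorb i b α β'' → Absorb i b α' β' → Answer (Absorb i b) α β l α'
  matched τs s r r' = inj₂ (_ , _ , τs , s , r , r')
  transfer : ∀ {α β α' l} → Absorb i b α β → Step α l α' → Answer (Absorb i b) α β l α'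
  transfer refl-rel s = matched ε s refl-rel refl-rel
  transfer (Z-left f) (step Z-τ) = inj₁ (refl , refl-rel)
  transfer (Z-left here) (step Z-a) = matched ε (step B-a) (Z-left here) refl-rel
  transfer (Z-left (there k≢i f)) (step Z-a) =
    matched ε (step (B-aj k≢i)) (Z-left (there k≢i f)) (Bp-right k≢i f)
  transfer (Z-right f) s = matched (step Z-τ ◅ ε) s refl-rel refl-rel
  transfer (Bp-left p f) (step Bp-a) = matched ε (step B-a) (Bp-left p f) (Bp-left p f)
  transfer (Bp-left p f) (step Bp-d) = matched ε (step B-d) (Bp-left p f) (Z-left f)
  transfer (Bp-left p f) (step (Bp-aj q)) = matched ε (step (B-aj q)) (Bp-left p f) refl-rel
  transfer (Bp-right p f) (step B-a) = matched ε (step Bp-a) (Bp-right p f) (Bp-right p f)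
  transfer (Bp-right p f) (step B-d) = matched ε (step Bp-d) (Bp-right p f) (Z-right f)
  transfer (Bp-right p f) (step (B-aj q)) = matched ε (step (Bp-aj q)) (Bp-right p f) refl-rel

firstIs⇒≃ : ∀ {n} {i : Fin n} {b γ} → FirstIs i b γ → (Z i b ∷ γ) ≃ γ
firstIs⇒≃ {i = i} {b} f = Absorb i b , absorb-bisim i b , Z-left f

τ-Stable : ∀ {n} → Proc n → Set
τ-Stable α = ∀ {α'} → ¬ TauStep α α'

stable-⇒ : ∀ {n} {β β'' : Proc n} → τ-Stable β → β ⇒ β'' → β'' ≡ β
stable-⇒ _  ε       = refl
stable-⇒ st (s ◅ _) = contradiction s st

𝓑*-stable : ∀ {n} {α : Proc n} → All IsB α → τ-Stable α
𝓑*-stable (isB ∷ _) (step ())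

Bp-stable : ∀ {n} {k : Fin n} {c j c'} .{k≢j : k ≢ j} {γ} → τ-Stable (Bp k c j c' k≢j ∷ γ)
Bp-stable (step ())

answer-stable : ∀ {n} {R : Proc n → Proc n → Set} {α β α' l} → IsBranchingBisim R →
                R α β → τ-Stable β → Step α l α' → l ≢ τ →
                ∃ λ β' → Step β l β' × R α' β'
answer-stable (_ , transfer) r st s l≢τ with transfer r s
... | inj₁ (l≡τ , _) = contradiction l≡τ l≢τ
... | inj₂ (_ , β' , τs , s' , _ , r') with stable-⇒ st τs
...   | refl = β' , s' , r'

-- The move a_i^b of Z_i^b must be answered by the head
-- B_k^c of α (the empty process cannot answer it): either (k, c) = (i, b), or k ≠ i and B_k^c(i,b)γ ~ B_k^c γ;
-- then the move d of B_k^c γ forces Z_i^b γ ~ γ and we recurse on γ.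
bisim⇒firstIs : ∀ {n} {R : Proc n → Proc n → Set} {i b} → IsBranchingBisim R →
                  {α : Proc n} → All IsB α → R (Z i b ∷ α) α → FirstIs i b α
bisim⇒firstIs bis [] r with answer-stable bis r (𝓑*-stable []) (step Z-a) (λ ())
... | _ , () , _
bisim⇒firstIs bis@(symR , _) allB@(isB ∷ allγ) r
  with answer-stable bis r (𝓑*-stable allB) (step Z-a) (λ ())
... | _ , step B-a , _ = here
... | _ , step (B-aj k≢i) , r' with answer-stable bis r' Bp-stable (step B-d) (λ ())
...   | _ , step Bp-d , r'' = there k≢i (bisim⇒firstIs bis allγ (symR r''))

≃⇒firstIs : ∀ {n} {i : Fin n} {b α} → All IsB α → (Z i b ∷ α) ≃ α → FirstIs i b α
≃⇒firstIs allB (_ , bis , r) = bisim⇒firstIs bis allB r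

Split : ∀ {n} → Fin n → Bool → Proc n → Set
Split i b α = ∃₂ λ α₁ α₂ → α ≡ α₁ ++ (B i b ∷ α₂) × B i (not b) ∉ α₁

firstIs⇒split : ∀ {n} {i : Fin n} {b α} → FirstIs i b α → Split i b α
firstIs⇒split (here {γ}) = [] , γ , refl , λ ()
firstIs⇒split (there {k} {c} k≢i f) with firstIs⇒split f
... | α₁ , α₂ , refl , ∉α₁ =
  B k c ∷ α₁ , α₂ , refl , λ { (here refl) → k≢i refl ; (there m) → ∉α₁ m }

-- Conversely, over 𝓑 the only variables of index i are B_i^b and B_i^{1-b},
-- so a prefix avoiding B_i^{1-b} either meets B_i^b or avoids index i.
split⇒firstIs : ∀ {n} {i : Fin n} {b α} → All IsB α → Split i b α → FirstIs i b α
split⇒firstIs _ ([] , _ , refl , _) = here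
split⇒firstIs {i = i} {b} (isB ∷ allB) (B k c ∷ α₁ , α₂ , refl , ∉α) with k ≟ᶠ i
... | no k≢i = there k≢i (split⇒firstIs allB (α₁ , α₂ , refl , λ m → ∉α (there m)))
... | yes refl with c ≟ᵇ b
...   | yes refl = here
...   | no c≢b   = contradiction (here (cong (B i) (sym (¬-not c≢b)))) ∉α

lemma11 : ∀ {n} (α : Proc n) → All IsB α → (i : Fin n) (b : Bool) →
          ((Z i b ∷ α) ≃ α ⇔ ∃₂ λ α₁ α₂ → α ≡ α₁ ++ (B i b ∷ α₂) × B i (not b) ∉ α₁)
          × ((Z i b ∷ α) ≃ α → ¬ ((Z i (not b) ∷ α) ≃ α))
lemma11 α allB i b = part₁ , part₂
  where
  part₁ : (Z i b ∷ α) ≃ α ⇔ Split i b α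
  part₁ = mk⇔ (λ z≃ → firstIs⇒split (≃⇒firstIs allB z≃))
              (λ split → firstIs⇒≃ (split⇒firstIs allB split))
  part₂ : (Z i b ∷ α) ≃ α → ¬ ((Z i (not b) ∷ α) ≃ α)
  part₂ z≃ z'≃ =
    not-¬ refl (firstIs-unique (≃⇒firstIs allB z≃) (≃⇒firstIs allB z'≃))
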